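{- Let $G=(V,E)$ be a weighted temporal graph with $m=|E|$ edges and let $s,z\in V$. The number of nondominated points in $\mathcal{Y}_A$ (arrival time and cost) is in $\mathcal{O}(m)$. The number of nondominated points in $\mathcal{Y}_F$ (duration and cost) is in $\mathcal{O}(\mathcal{S}\cdot m)=\mathcal{O}(m^2)$, where $\mathcal{S}$ is the number of distinct availability times of edges leaving $s$.
   Context: A weighted temporal graph $G=(V,E)$ consists of a finite vertex set $V$ and a finite set $E$ of temporal edges $e=(u,v,t,\lambda,c)$ with $u\neq v$, availability time $t\in\mathbb{N}$, traversal time $\lambda\in\mathbb{N}$, cost $c\in\mathbb{R}_{\geq0}$. A temporal $(u,v)$-path is a sequence of edges $(e_1,\ldots,e_k)$, $e_i=(v_i,v_{i+1},t_i,\lambda_i,c_i)\in E$, with $v_1=u$, $v_{k+1}=v$, $t_i+\lambda_i\leq t_{i+1}$ for $1\le i<k$, visiting each vertex at most once. Its starting time is $s(P)=t_1$, arrival time $a(P)=t_k+\lambda_k$, duration $d(P)=a(P)-s(P)$, cost $c(P)=\sum_i c_i$. $\mathcal{Y}_A=\{(a(P),c(P))\}$ and $\mathcal{Y}_F=\{(d(P),c(P))\}$, where $P$ ranges over all $(s,z)$-paths. A point $(f_1,c_1)$ dominates $(f_2,c_2)$ if ($c_1<c_2$ and $f_1\le f_2$) or ($c_1\le c_2$ and $f_1<f_2$); a point of the objective space is nondominated if no point of that space dominates it.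
   Formalization: The edge costs are nonnegative rationals instead of nonnegative reals. -}

module Defs where

open import Data.Nat using (ℕ; _+_; _*_; _∸_; _≤_; _<_)
open import Data.Fin using (Fin)
open import Data.Fin.Properties using () renaming (_≟_ to _≟ᶠ_)
open import Data.Rational using (ℚ; 0ℚ) renaming (_+_ to _+ℚ_; _≤_ to _≤ℚ_; _<_ to _<ℚ_)
open import Data.List using (List; []; _∷_; [_]; map; foldr; length; filter; deduplicate)
open import Data.List.Membership.Propositional using (_∈_)
open import Data.List.Relation.Unary.Unique.Propositional using (Unique)
open import Data.Product using (_×_; _,_; Σ; ∃; ∃-syntax)
open import Data.Sum using (_⊎_)
open import Relation.Nullary using (¬_)
open import Relation.Binary.PropositionalEquality using (_≡_; _≢_)
import Data.Nat.Properties as ℕP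

record Edge (n : ℕ) : Set where
  constructor mkEdge
  field
    src     : Fin n
    tgt     : Fin n
    src≢tgt : src ≢ tgt
    time    : ℕ
    trav    : ℕ
    cost    : ℚ
    cost≥0  : 0ℚ ≤ℚ cost
open Edge public

-- points of the objective space: (arrival time or duration, cost)
Point : Set
Point = ℕ × ℚ

module _ {n : ℕ} where

  data TWalk (E : List (Edge n)) : Fin n → Fin n → List (Edge n) → Set where
    single : ∀ {e} → e ∈ E → TWalk E (src e) (tgt e) [ e ]
    step   : ∀ {e e′ es v} → e ∈ E → tgt e ≡ src e′ →
             time e + trav e ≤ time e′ →
             TWalk E (src e′) v (e′ ∷ es) →
             TWalk E (src e) v (e ∷ e′ ∷ es)

  vertices : List (Edge n) → List (Fin n)
  vertices []       = []
  vertices (e ∷ es) = src e ∷ map tgt (e ∷ es)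

  record TPath (E : List (Edge n)) (u v : Fin n) : Set where
    constructor mkPath
    field
      edges  : List (Edge n)
      walk   : TWalk E u v edges
      simple : Unique (vertices edges)
  open TPath public

  startL : List (Edge n) → ℕ
  startL []      = 0
  startL (e ∷ _) = time e

  arrivalL : List (Edge n) → ℕ
  arrivalL []           = 0
  arrivalL (e ∷ [])     = time e + trav e
  arrivalL (_ ∷ e ∷ es) = arrivalL (e ∷ es)

  costL : List (Edge n) → ℚ
  costL = foldr (λ e acc → cost e +ℚ acc) 0ℚ

  s[_] a[_] d[_] : ∀ {E u v} → TPath E u v → ℕ
  s[ P ] = startL (edges P)
  a[ P ] = arrivalL (edges P)
  d[ P ] = a[ P ] ∸ s[ P ]

  c[_] : ∀ {E u v} → TPath E u v → ℚ
  c[ P ] = costL (edges P)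

  InYA : List (Edge n) → Fin n → Fin n → Point → Set
  InYA E s z (f , c) = Σ (TPath E s z) λ P → a[ P ] ≡ f × c[ P ] ≡ c

  InYF : List (Edge n) → Fin n → Fin n → Point → Set
  InYF E s z (f , c) = Σ (TPath E s z) λ P → d[ P ] ≡ f × c[ P ] ≡ c

Dominates : Point → Point → Set
Dominates (f₁ , c₁) (f₂ , c₂) = (c₁ <ℚ c₂ × f₁ ≤ f₂) ⊎ (c₁ ≤ℚ c₂ × f₁ < f₂)

Nondominated : (Point → Set) → Point → Set
Nondominated Y p = Y p × ¬ (∃[ q ] (Y q × Dominates q p))

numStartTimes : ∀ {n} → List (Edge n) → Fin n → ℕ
numStartTimes E s =
  length (deduplicate ℕP._≟_ (map time (filter (λ e → src e ≟ᶠ s) E)))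

{-# OPTIONS --safe #-}
module Submission where

-- Costs are totally ordered, so two nondominated points with the same time
-- coordinate coincide: otherwise the cheaper one dominates the other.  Hence
-- nondominated points are at most as many as the possible time values.  An
-- arrival time is t + λ of the last edge of the path, so there are at most m
-- of them; a duration is such an arrival time minus the availability time of
-- an edge leaving s, so there are at most 𝒮 · m ≤ m² of them.

open import Defs
open import Data.Nat using (ℕ; _*_; _≤_; _+_; _∸_)
open import Data.Nat.Properties using (_≟_; ≤-refl; ≤-trans; m≤n*m; *-monoˡ-≤; module ≤-Reasoning)
open import Data.Fin using (Fin; zero; suc)
open import Data.Fin.Properties using (injective⇒≤) renaming (_≟_ to _≟ᶠ_)
open import Data.List using (List; []; _∷_; length; lookup; map; filter; _++_; deduplicate; cartesianProductWith)
open import Data.List.Properties using (length-map; length-filter; length-deduplicate; length-++)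
open import Data.List.Relation.Unary.All as All using (All)
open import Data.List.Relation.Unary.Any as Any using ()
open import Data.List.Relation.Unary.Unique.Propositional using (Unique; _∷_)
open import Data.List.Membership.Propositional using (_∈_)
open import Data.List.Membership.Propositional.Properties
  using (∈-lookup; ∈-map⁺; ∈-filter⁺; ∈-deduplicate⁺; ∈-cartesianProductWith⁺)
open import Data.List.Membership.Setoid.Properties using (index-injective)
open import Data.Product using (_×_; ∃-syntax; _,_; proj₁)
open import Data.Sum using (inj₁)
open import Data.Rational.Properties using (<-cmp)
open import Relation.Binary.Definitions using (tri<; tri≈; tri>)
open import Relation.Binary.PropositionalEquality using (_≡_; refl; sym; cong; cong₂; setoid; module ≡-Reasoning)
open import Relation.Nullary using (contradiction)

module _ {A : Set} where

  lookup-injective : ∀ {xs : List A} → Unique xs → ∀ {i j} → lookup xs i ≡ lookup xs j → i ≡ j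
  lookup-injective (_    ∷ _) {zero}  {zero}  _  = refl
  lookup-injective (x∉xs ∷ _) {zero}  {suc j} eq = contradiction eq (All.lookup x∉xs (∈-lookup j))
  lookup-injective (x∉xs ∷ _) {suc i} {zero}  eq = contradiction (sym eq) (All.lookup x∉xs (∈-lookup i))
  lookup-injective (_    ∷ u) {suc i} {suc j} eq = cong suc (lookup-injective u eq)

  injectiveOn⇒length≤ : ∀ {B : Set} {P : A → Set} (f : A → B) →
                        (∀ {x y} → P x → P y → f x ≡ f y → x ≡ y) →
                        ∀ {xs ys} → Unique xs → All P xs → All (λ x → f x ∈ ys) xs →
                        length xs ≤ length ys
  injectiveOn⇒length≤ {B = B} f f-inj {xs} {ys} xs! Pxs fxs⊆ys = injective⇒≤ {f = position} position-injective
    where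
    position : Fin (length xs) → Fin (length ys)
    position i = Any.index (All.lookup fxs⊆ys (∈-lookup i))

    position-injective : ∀ {i j} → position i ≡ position j → i ≡ j
    position-injective {i} {j} eq = lookup-injective xs!
      (f-inj (All.lookup Pxs (∈-lookup i)) (All.lookup Pxs (∈-lookup j))
             (index-injective (setoid B) (All.lookup fxs⊆ys (∈-lookup i)) (All.lookup fxs⊆ys (∈-lookup j)) eq))

module _ (Y : Point → Set) where

  nondominated-proj₁-injective : ∀ {p q} → Nondominated Y p → Nondominated Y q →
                                 proj₁ p ≡ proj₁ q → p ≡ q
  nondominated-proj₁-injective {f , c} {.f , d} (Yp , p-min) (Yq , q-min) refl with <-cmp c d
  ... | tri< c<d _ _ = contradiction ((f , c) , Yp , inj₁ (c<d , ≤-refl)) q-min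
  ... | tri≈ _ c≡d _ = cong (f ,_) c≡d
  ... | tri> _ _ d<c = contradiction ((f , d) , Yq , inj₁ (d<c , ≤-refl)) p-min

  length-nondominated≤ : ∀ {D : List ℕ} → (∀ {p} → Y p → proj₁ p ∈ D) →
                         ∀ {ps} → Unique ps → All (Nondominated Y) ps → length ps ≤ length D
  length-nondominated≤ Y⊆D ps! nd-ps =
    injectiveOn⇒length≤ proj₁ nondominated-proj₁-injective ps! nd-ps (All.map (λ (Yp , _) → Y⊆D Yp) nd-ps)

length-cartesianProductWith : ∀ {A B C : Set} (f : A → B → C) (xs : List A) (ys : List B) →
                              length (cartesianProductWith f xs ys) ≡ length xs * length ys
length-cartesianProductWith f []       ys = refl
length-cartesianProductWith f (x ∷ xs) ys = begin
  length (map (f x) ys ++ cartesianProductWith f xs ys)          ≡⟨ length-++ (map (f x) ys) ⟩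
  length (map (f x) ys) + length (cartesianProductWith f xs ys)  ≡⟨ cong₂ _+_ (length-map (f x) ys)
                                                                            (length-cartesianProductWith f xs ys) ⟩
  length ys + length xs * length ys                               ∎
  where open ≡-Reasoning

module _ {n : ℕ} (E : List (Edge n)) where

  arrivalTime : Edge n → ℕ
  arrivalTime e = time e + trav e

  edgesFrom : Fin n → List (Edge n)
  edgesFrom s = filter (λ e → src e ≟ᶠ s) E

  startTimes : Fin n → List ℕ
  startTimes s = deduplicate _≟_ (map time (edgesFrom s))

  durations : Fin n → List ℕ
  durations s = cartesianProductWith (λ t a → a ∸ t) (startTimes s) (map arrivalTime E)

  numStartTimes≤length : ∀ s → numStartTimes E s ≤ length E
  numStartTimes≤length s = begin
    numStartTimes E s                  ≤⟨ length-deduplicate _≟_ (map time (edgesFrom s)) ⟩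
    length (map time (edgesFrom s))    ≡⟨ length-map time (edgesFrom s) ⟩
    length (edgesFrom s)               ≤⟨ length-filter (λ e → src e ≟ᶠ s) E ⟩
    length E                           ∎
    where open ≤-Reasoning

  length-durations : ∀ s → length (durations s) ≡ numStartTimes E s * length E
  length-durations s = begin
    length (durations s)                                ≡⟨ length-cartesianProductWith _ (startTimes s) _ ⟩
    numStartTimes E s * length (map arrivalTime E)      ≡⟨ cong (numStartTimes E s *_) (length-map arrivalTime E) ⟩
    numStartTimes E s * length E                        ∎
    where open ≡-Reasoning

  arrivalL-∈ : ∀ {u v es} → TWalk E u v es → arrivalL es ∈ map arrivalTime E
  arrivalL-∈ (single e∈E)      = ∈-map⁺ arrivalTime e∈E
  arrivalL-∈ (step _ _ _ rest) = arrivalL-∈ rest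

  time-∈-startTimes : ∀ {e} → e ∈ E → time e ∈ startTimes (src e)
  time-∈-startTimes e∈E = ∈-deduplicate⁺ _≟_ (∈-map⁺ time (∈-filter⁺ (λ e → src e ≟ᶠ _) e∈E refl))

  startL-∈ : ∀ {u v es} → TWalk E u v es → startL es ∈ startTimes u
  startL-∈ (single e∈E)     = time-∈-startTimes e∈E
  startL-∈ (step e∈E _ _ _) = time-∈-startTimes e∈E

  YA-arrival-∈ : ∀ {s z p} → InYA E s z p → proj₁ p ∈ map arrivalTime E
  YA-arrival-∈ (P , refl , _) = arrivalL-∈ (walk P)

  YF-duration-∈ : ∀ {s z p} → InYF E s z p → proj₁ p ∈ durations s
  YF-duration-∈ (P , refl , _) =
    ∈-cartesianProductWith⁺ (λ t a → a ∸ t) (startL-∈ (walk P)) (arrivalL-∈ (walk P))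

  length-nondominated-YA≤ : ∀ {s z ps} → Unique ps → All (Nondominated (InYA E s z)) ps →
                            length ps ≤ length E
  length-nondominated-YA≤ {s} {z} {ps} ps! nd-ps = begin
    length ps                    ≤⟨ length-nondominated≤ (InYA E s z) YA-arrival-∈ ps! nd-ps ⟩
    length (map arrivalTime E)   ≡⟨ length-map arrivalTime E ⟩
    length E                     ∎
    where open ≤-Reasoning

  length-nondominated-YF≤ : ∀ {s z ps} → Unique ps → All (Nondominated (InYF E s z)) ps →
                            length ps ≤ numStartTimes E s * length E
  length-nondominated-YF≤ {s} {z} {ps} ps! nd-ps = begin
    length ps                      ≤⟨ length-nondominated≤ (InYF E s z) YF-duration-∈ ps! nd-ps ⟩
    length (durations s)           ≡⟨ length-durations s ⟩
    numStartTimes E s * length E   ∎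
    where open ≤-Reasoning

lemma2 : (∃[ K ] ∀ (n : ℕ) (E : List (Edge n)) → Unique E → (s z : Fin n) →
    (ps : List Point) → Unique ps → All (Nondominated (InYA E s z)) ps →
    length ps ≤ K * length E)
    × (∃[ K ] ∀ (n : ℕ) (E : List (Edge n)) → Unique E → (s z : Fin n) →
    (ps : List Point) → Unique ps → All (Nondominated (InYF E s z)) ps →
    length ps ≤ K * (numStartTimes E s * length E))
    × (∃[ K ] ∀ (n : ℕ) (E : List (Edge n)) → Unique E → (s z : Fin n) →
    (ps : List Point) → Unique ps → All (Nondominated (InYF E s z)) ps →
    length ps ≤ K * (length E * length E))
lemma2 =
    (1 , λ n E _ s z ps ps! nd-ps → ≤-trans (length-nondominated-YA≤ E ps! nd-ps) (m≤n*m _ 1))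
  , (1 , λ n E _ s z ps ps! nd-ps → ≤-trans (length-nondominated-YF≤ E ps! nd-ps) (m≤n*m _ 1))
  , (1 , λ n E _ s z ps ps! nd-ps → ≤-trans (length-nondominated-YF≤ E ps! nd-ps)
                                      (≤-trans (*-monoˡ-≤ (length E) (numStartTimes≤length E s)) (m≤n*m _ 1)))
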